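{- Let $m,n>1$ be integers and $p=\gcd(m,n)$. (1) If $\gcd(m,pn)=p$, then $\rho^{ -1}(\ell^\infty)$ is a line on $T_{m\times n}$, where $\ell^\infty=\{\pi_{p,p}(0,k):k\in\mathbb Z\}$. (2) If $\gcd(pm,n)=p$, then $\rho^{ -1}(\ell^0)$ is a line on $T_{m\times n}$, where $\ell^0=\{\pi_{p,p}(k,0):k\in\mathbb Z\}$.
   Context: For integers $m,n>1$, the discrete torus is $T_{m\times n}=\{0,\dots,m-1\}\times\{0,\dots,n-1\}$, with projection $\pi_{m,n}:\mathbb Z\times\mathbb Z\to T_{m\times n}$, $\pi_{m,n}(a,b)=(a \bmod m,\ b\bmod n)$ (least non-negative remainders); similarly for $T_{p\times p}$ and $\pi_{p,p}$. A line in $\mathbb Z\times\mathbb Z$ is a set $\{(a+uk,b+vk):k\in\mathbb Z\}$ with $a,b,u,v\in\mathbb Z$ and $\gcd(u,v)=1$. A line on $T_{m\times n}$ is the image under $\pi_{m,n}$ of a line in $\mathbb Z\times\mathbb Z$. The map $\rho:T_{m\times n}\to T_{p\times p}$ is $\rho(u,v)=(u\bmod p, v\bmod p)$. -}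

module Defs where

open import Data.Nat as ℕ using (ℕ; zero; suc; _<_)
open import Data.Integer as ℤ using (ℤ; +_; _+_; _*_; _%ℕ_)
open import Data.Integer.GCD using () renaming (gcd to gcdℤ)
open import Data.Product using (Σ; ∃; ∃-syntax; _×_; _,_)
open import Function.Bundles using (_⇔_)
open import Relation.Binary.PropositionalEquality using (_≡_)

-- least non-negative remainder of an integer modulo a natural number.
-- (The modulus 0 never occurs in the statement since m, n > 1; we return 0 there.)
_mod_ : ℤ → ℕ → ℕ
a mod zero    = 0
a mod (suc k) = a %ℕ suc k

ℤ² : Set
ℤ² = ℤ × ℤ

ℕ² : Set
ℕ² = ℕ × ℕ

Subset : Set₁
Subset = ℕ² → Set

T : ℕ → ℕ → Subset
T m n (x , y) = (x < m) × (y < n)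

π : ℕ → ℕ → ℤ² → ℕ²
π m n (a , b) = (a mod m , b mod n)

ρ : ℕ → ℕ² → ℕ²
ρ p (x , y) = ((+ x) mod p , (+ y) mod p)

LineZ² : ℤ → ℤ → ℤ → ℤ → ℤ² → Set
LineZ² a b u v z = ∃[ k ] (a + u * k , b + v * k) ≡ z

IsLineOn : ℕ → ℕ → Subset → Set
IsLineOn m n S =
  ∃[ a ] ∃[ b ] ∃[ u ] ∃[ v ] (gcdℤ u v ≡ + 1) ×
    (∀ (P : ℕ²) → S P ⇔ (∃[ z ] LineZ² a b u v z × π m n z ≡ P))

ρ⁻¹ : ℕ → ℕ → ℕ → Subset → Subset
ρ⁻¹ m n p L P = T m n P × L (ρ p P)

ℓ∞ : ℕ → Subset
ℓ∞ p P = ∃[ k ] π p p (+ 0 , k) ≡ P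

ℓ0 : ℕ → Subset
ℓ0 p P = ∃[ k ] π p p (k , + 0) ≡ P

-- Write m = p M. Since gcd (p M) (p n) = p gcd M n, the hypothesis gcd(m, p n) = p says that M and n
-- are coprime. A torus point (x , y) lies in ρ⁻¹(ℓ∞) exactly when p ∣ x, and these points form the image
-- of the line k ↦ (p k , k): p k mod p M is again a multiple of p, and conversely for x = p x′ the Chinese
-- remainder theorem gives k ≡ x′ (mod M) and k ≡ y (mod n), so that p k ≡ x (mod m).
-- Part (2) is part (1) with the two coordinates exchanged.
module Submission where

open import Defs
open import Data.Nat as ℕ using (ℕ; zero; suc; NonZero; _<_)
import Data.Nat.Properties as ℕ
open import Data.Nat.Divisibility as ℕ using (>⇒∤; m%n≡0⇒n∣m; n∣m⇒m%n≡0; m∣n⇒n≡m*quotient)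
open import Data.Nat.GCD using (gcd; gcd-comm; gcd[m,n]∣m; gcd[m,n]∣n; gcd[m,n]≢0; c*gcd[m,n]≡gcd[cm,cn]; module Bézout)
open import Data.Nat.Coprimality using (Coprime; coprime-Bézout; gcd≡1⇒coprime)
open import Data.Integer as ℤ using (ℤ; +_; -_; _+_; _*_; _-_; _%ℕ_; _/ℕ_; ∣_∣)
open import Data.Integer.Properties
open import Data.Integer.DivMod using (a≡a%ℕn+[a/ℕn]*n; n%ℕd<d)
import Data.Integer.Divisibility.Signed as ℤ
import Data.Integer.GCD as ℤ
open import Data.Integer.Tactic.RingSolver using (solve; solve-∀)
open import Data.List using (_∷_; [])
open import Data.Product using (∃₂; ∃-syntax; _×_; _,_; proj₁; swap)
open import Data.Product.Function.NonDependent.Propositional using (_×-⇔_)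
open import Data.Sum using (inj₁)
open import Function.Base using (_∘_)
open import Function.Bundles using (_⇔_; mk⇔)
open import Function.Construct.Composition using (_⇔-∘_)
open import Function.Construct.Identity using (⇔-id)
open import Function.Construct.Symmetry using (⇔-sym)
open import Relation.Nullary using (contradiction)
open import Relation.Binary.PropositionalEquality

∣∧<⇒≡0 : ∀ {d e} → d ℕ.∣ e → e < d → e ≡ 0
∣∧<⇒≡0 {e = zero}  _   _   = refl
∣∧<⇒≡0 {e = suc _} d∣e e<d = contradiction d∣e (>⇒∤ e<d)

%ℕ-unique : ∀ {a r} c d .{{_ : NonZero d}} → r < d → a ≡ + r + c * + d → a %ℕ d ≡ r
%ℕ-unique {a} {r} c d r<d a≡r+cd =
  +-injective (i-j≡0⇒i≡j (+ r′) (+ r) (∣i∣≡0⇒i≡0 (∣∧<⇒≡0 d∣r′-r r′-r<d)))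
  where
  r′ : ℕ
  r′ = a %ℕ d
  q : ℤ
  q = a /ℕ d
  shift : ∀ x y q c d → x + q * d ≡ y + c * d → x - y ≡ (c - q) * d
  shift x y q c d eq = begin
    x - y                   ≡⟨ solve (x ∷ y ∷ q ∷ c ∷ d ∷ []) ⟩
    (x + q * d) - y - q * d ≡⟨ cong (λ w → w - y - q * d) eq ⟩
    (y + c * d) - y - q * d ≡⟨ solve (x ∷ y ∷ q ∷ c ∷ d ∷ []) ⟩
    (c - q) * d             ∎
    where open ≡-Reasoning
  d∣r′-r : d ℕ.∣ ∣ + r′ - + r ∣
  d∣r′-r = ℤ.∣⇒∣ᵤ (ℤ.divides (c - q)
    (shift (+ r′) (+ r) q c (+ d) (trans (sym (a≡a%ℕn+[a/ℕn]*n a d)) a≡r+cd)))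
  r′-r<d : ∣ + r′ - + r ∣ < d
  r′-r<d = subst (_< d) (cong ∣_∣ (sym (m-n≡m⊖n r′ r)))
    (ℕ.≤-<-trans (∣m⊝n∣≤m⊔n r′ r) (ℕ.⊔-pres-<m (n%ℕd<d a d) r<d))

%ℕ-preserves-∣ : ∀ {d} a m .{{_ : NonZero m}} → d ℕ.∣ m → + d ℤ.∣ a → d ℕ.∣ a %ℕ m
%ℕ-preserves-∣ {d} a m d∣m d∣a = ℤ.∣⇒∣ᵤ (ℤ.∣m+n∣n⇒∣m {+ d} {+ (a %ℕ m)}
  (subst (+ d ℤ.∣_) (a≡a%ℕn+[a/ℕn]*n a m) d∣a)
  (ℤ.∣n⇒∣m*n (a /ℕ m) (ℤ.∣ᵤ⇒∣ d∣m)))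

1+yb≡xa⇒xa-yb≡1 : ∀ x a y b → 1 ℕ.+ y ℕ.* b ≡ x ℕ.* a → + x * + a + - + y * + b ≡ + 1
1+yb≡xa⇒xa-yb≡1 x a y b eq = begin
  + x * + a + - + y * + b         ≡⟨ cong (_+ - + y * + b) (pos-* x a) ⟨
  + (x ℕ.* a) + - + y * + b       ≡⟨ cong (λ w → + w + - + y * + b) eq ⟨
  + (1 ℕ.+ y ℕ.* b) + - + y * + b ≡⟨ cong (_+ - + y * + b) (pos-+ 1 (y ℕ.* b)) ⟩
  + 1 + + (y ℕ.* b) + - + y * + b ≡⟨ cong (λ w → + 1 + w + - + y * + b) (pos-* y b) ⟩
  + 1 + + y * + b + - + y * + b   ≡⟨ cancel (+ y) (+ b) ⟩
  + 1                             ∎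
  where
  open ≡-Reasoning
  cancel : ∀ u v → + 1 + u * v + - u * v ≡ + 1
  cancel = solve-∀

coprime⇒ℤ-Bézout : ∀ {a b} → Coprime a b → ∃₂ λ s t → s * + a + t * + b ≡ + 1
coprime⇒ℤ-Bézout {a} {b} a⊥b with coprime-Bézout a⊥b
... | Bézout.+- x y eq = + x , - + y , 1+yb≡xa⇒xa-yb≡1 x a y b eq
... | Bézout.-+ x y eq = - + x , + y , trans (+-comm (- + x * + a) (+ y * + b)) (1+yb≡xa⇒xa-yb≡1 y b x a eq)

chinese-remainder : ∀ {a b} → Coprime a b → ∀ x y →
  ∃[ k ] (∃[ c ] k ≡ x + c * + a) × (∃[ c ] k ≡ y + c * + b)
chinese-remainder {a} {b} a⊥b x y with coprime⇒ℤ-Bézout a⊥b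
... | s , t , sa+tb≡1 =
  x * t * + b + y * s * + a ,
  ((y - x) * s , shift x y s t (+ a) (+ b) sa+tb≡1) ,
  ((x - y) * t , trans (+-comm (x * t * + b) (y * s * + a))
                       (shift y x t s (+ b) (+ a) (trans (+-comm (t * + b) (s * + a)) sa+tb≡1)))
  where
  shift : ∀ x y s t a b → s * a + t * b ≡ + 1 → x * t * b + y * s * a ≡ x + (y - x) * s * a
  shift x y s t a b eq = begin
    x * t * b + y * s * a                 ≡⟨ solve (x ∷ y ∷ s ∷ t ∷ a ∷ b ∷ []) ⟩
    x * (s * a + t * b) + (y - x) * s * a ≡⟨ cong (λ w → x * w + (y - x) * s * a) eq ⟩
    x * + 1 + (y - x) * s * a             ≡⟨ cong (_+ (y - x) * s * a) (*-identityʳ x) ⟩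
    x + (y - x) * s * a                   ∎
    where open ≡-Reasoning

mod≡%ℕ : ∀ a m .{{_ : NonZero m}} → a mod m ≡ a %ℕ m
mod≡%ℕ a (suc _) = refl

mod<modulus : ∀ a m .{{_ : NonZero m}} → a mod m < m
mod<modulus a m = subst (_< m) (sym (mod≡%ℕ a m)) (n%ℕd<d a m)

ℓ∞∘ρ⇔∣ : ∀ p .{{_ : NonZero p}} x y → ℓ∞ p (ρ p (x , y)) ⇔ p ℕ.∣ x
ℓ∞∘ρ⇔∣ p@(suc _) x y = mk⇔
  (λ (_ , eq) → m%n≡0⇒n∣m x p (sym (cong proj₁ eq)))
  (λ p∣x → + y , cong (_, y ℕ.% p) (sym (n∣m⇒m%n≡0 x p p∣x)))

origin-line-image⇔ : ∀ m n u v P →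
  (∃[ z ] LineZ² (+ 0) (+ 0) u v z × π m n z ≡ P) ⇔ (∃[ k ] π m n (u * k , v * k) ≡ P)
origin-line-image⇔ m n u v P = mk⇔
  (λ { (_ , (k , refl) , eq) → k , trans (cong (π m n) (sym (drop-origin k))) eq })
  (λ (k , eq) → _ , (k , refl) , trans (cong (π m n) (drop-origin k)) eq)
  where
  drop-origin : ∀ k → (+ 0 + u * k , + 0 + v * k) ≡ (u * k , v * k)
  drop-origin k = cong₂ _,_ (+-identityˡ (u * k)) (+-identityˡ (v * k))

line-image⇔multiples : ∀ {m n} p M .{{_ : NonZero m}} .{{_ : NonZero n}} →
  m ≡ p ℕ.* M → Coprime M n → ∀ x y →
  (∃[ k ] π m n (+ p * k , + 1 * k) ≡ (x , y)) ⇔ (T m n (x , y) × p ℕ.∣ x)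
line-image⇔multiples {m} {n} p M m≡pM M⊥n x y = mk⇔
  (λ { (k , refl) →
    (mod<modulus (+ p * k) m , mod<modulus (+ 1 * k) n) ,
    subst (p ℕ.∣_) (sym (mod≡%ℕ (+ p * k) m))
      (%ℕ-preserves-∣ (+ p * k) m (ℕ.divides M (trans m≡pM (ℕ.*-comm p M))) (ℤ.∣m⇒∣m*n k ℤ.∣-refl)) })
  (λ { ((x<m , y<n) , ℕ.divides x′ refl) → solution x′ x<m y<n })
  where
  solution : ∀ x′ → x′ ℕ.* p < m → y < n → ∃[ k ] π m n (+ p * k , + 1 * k) ≡ (x′ ℕ.* p , y)
  solution x′ x<m y<n =
    let k , (c , k≡x′+cM) , (c′ , k≡y+c′n) = chinese-remainder M⊥n (+ x′) (+ y)
    in k , cong₂ _,_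
      (trans (mod≡%ℕ (+ p * k) m) (%ℕ-unique c m x<m (begin
        + p * k                         ≡⟨ cong (+ p *_) k≡x′+cM ⟩
        + p * (+ x′ + c * + M)          ≡⟨ distrib (+ p) (+ x′) c (+ M) ⟩
        + x′ * + p + c * (+ p * + M)    ≡⟨ cong₂ (λ u w → u + c * w) (pos-* x′ p) (pos-* p M) ⟨
        + (x′ ℕ.* p) + c * + (p ℕ.* M)  ≡⟨ cong (λ w → + (x′ ℕ.* p) + c * + w) m≡pM ⟨
        + (x′ ℕ.* p) + c * + m          ∎)))
      (trans (mod≡%ℕ (+ 1 * k) n) (%ℕ-unique c′ n y<n (trans (*-identityˡ k) k≡y+c′n)))
    where
    open ≡-Reasoning
    distrib : ∀ p x c M → p * (x + c * M) ≡ x * p + c * (p * M)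
    distrib = solve-∀

ρ⁻¹ℓ∞-isLine : ∀ {m n} p M .{{_ : NonZero m}} .{{_ : NonZero n}} .{{_ : NonZero p}} →
  m ≡ p ℕ.* M → Coprime M n → IsLineOn m n (ρ⁻¹ m n p (ℓ∞ p))
ρ⁻¹ℓ∞-isLine {m} {n} p M m≡pM M⊥n = + 0 , + 0 , + p , + 1 , ℤ.gcd-zeroʳ (+ p) , λ { (x , y) →
  ⇔-sym (origin-line-image⇔ m n (+ p) (+ 1) (x , y))
    ⇔-∘ (⇔-sym (line-image⇔multiples p M m≡pM M⊥n x y)
    ⇔-∘ (⇔-id _ ×-⇔ ℓ∞∘ρ⇔∣ p x y)) }

IsLineOn-swap : ∀ {m n} {S : Subset} → IsLineOn n m S → IsLineOn m n (S ∘ swap)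
IsLineOn-swap {m} {n} {S} (a , b , u , v , gcd[u,v]≡1 , S⇔image) =
  b , a , v , u , trans (ℤ.gcd-comm v u) gcd[u,v]≡1 , λ P → swap-image P ⇔-∘ S⇔image (swap P)
  where
  swap-image : ∀ P → (∃[ z ] LineZ² a b u v z × π n m z ≡ swap P) ⇔ (∃[ z ] LineZ² b a v u z × π m n z ≡ P)
  swap-image P = mk⇔
    (λ { (_ , (k , refl) , eq) → _ , (k , refl) , cong swap eq })
    (λ { (_ , (k , refl) , eq) → _ , (k , refl) , cong swap eq })

IsLineOn-cong : ∀ {m n} {S S′ : Subset} → (∀ P → S P ⇔ S′ P) → IsLineOn m n S → IsLineOn m n S′
IsLineOn-cong S⇔S′ (a , b , u , v , g , S⇔image) = a , b , u , v , g , λ P → S⇔image P ⇔-∘ ⇔-sym (S⇔S′ P)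

ρ⁻¹ℓ0⇔ρ⁻¹ℓ∞∘swap : ∀ m n p P → ρ⁻¹ m n p (ℓ0 p) P ⇔ ρ⁻¹ n m p (ℓ∞ p) (swap P)
ρ⁻¹ℓ0⇔ρ⁻¹ℓ∞∘swap m n p (x , y) = mk⇔
  (λ ((x<m , y<n) , k , eq) → (y<n , x<m) , k , cong swap eq)
  (λ ((y<n , x<m) , k , eq) → (x<m , y<n) , k , cong swap eq)

ρ⁻¹ℓ0-isLine : ∀ {m n} p N .{{_ : NonZero m}} .{{_ : NonZero n}} .{{_ : NonZero p}} →
  n ≡ p ℕ.* N → Coprime N m → IsLineOn m n (ρ⁻¹ m n p (ℓ0 p))
ρ⁻¹ℓ0-isLine {m} {n} p N n≡pN N⊥m = IsLineOn-cong {m} {n}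
  (λ P → ⇔-sym (ρ⁻¹ℓ0⇔ρ⁻¹ℓ∞∘swap m n p P))
  (IsLineOn-swap {m} {n} (ρ⁻¹ℓ∞-isLine p N n≡pN N⊥m))

gcd[cm,cn]≡c⇒coprime : ∀ c m n .{{_ : NonZero c}} → gcd (c ℕ.* m) (c ℕ.* n) ≡ c → Coprime m n
gcd[cm,cn]≡c⇒coprime c m n eq = gcd≡1⇒coprime (ℕ.*-cancelˡ-≡ (gcd m n) 1 c
  (trans (c*gcd[m,n]≡gcd[cm,cn] c m n) (trans eq (sym (ℕ.*-identityʳ c)))))

lemma4p4 : (m n : ℕ) → 1 < m → 1 < n →
    ((gcd m (gcd m n ℕ.* n) ≡ gcd m n) → IsLineOn m n (ρ⁻¹ m n (gcd m n) (ℓ∞ (gcd m n))))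
    × ((gcd (gcd m n ℕ.* m) n ≡ gcd m n) → IsLineOn m n (ρ⁻¹ m n (gcd m n) (ℓ0 (gcd m n))))
lemma4p4 m n 1<m 1<n =
  (λ gcd[m,pn]≡p → ρ⁻¹ℓ∞-isLine p M m≡pM (gcd[cm,cn]≡c⇒coprime p M n
    (subst (λ w → gcd w (p ℕ.* n) ≡ p) m≡pM gcd[m,pn]≡p))) ,
  (λ gcd[pm,n]≡p → ρ⁻¹ℓ0-isLine p N n≡pN (gcd[cm,cn]≡c⇒coprime p N m
    (trans (gcd-comm (p ℕ.* N) (p ℕ.* m)) (subst (λ w → gcd (p ℕ.* m) w ≡ p) n≡pN gcd[pm,n]≡p))))
  where
  p M N : ℕ
  p = gcd m n
  M = ℕ.quotient (gcd[m,n]∣m m n)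
  N = ℕ.quotient (gcd[m,n]∣n m n)
  m≡pM : m ≡ p ℕ.* M
  m≡pM = m∣n⇒n≡m*quotient (gcd[m,n]∣m m n)
  n≡pN : n ≡ p ℕ.* N
  n≡pN = m∣n⇒n≡m*quotient (gcd[m,n]∣n m n)
  instance
    m≢0 : NonZero m
    m≢0 = ℕ.>-nonZero (ℕ.m<n⇒0<n 1<m)
    n≢0 : NonZero n
    n≢0 = ℕ.>-nonZero (ℕ.m<n⇒0<n 1<n)
    p≢0 : NonZero p
    p≢0 = ℕ.≢-nonZero (gcd[m,n]≢0 m n (inj₁ (ℕ.≢-nonZero⁻¹ m)))
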